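{- Let $N>1$ be an integer and let $z_1,\dots,z_N$ be pairwise distinct nonzero complex numbers. Define the complementary sequence $\tilde z_1,\dots,\tilde z_N$ by $$\frac{1}{\tilde z_k}=\sum_{i=1}^{k-1}\frac{1}{z_i-z_k}+\sum_{i=k+1}^{N}\left(\frac{1}{z_i-z_k}-\frac{1}{z_i}\right),\qquad 1\le k\le N,$$ where an empty sum is $0$. Then, as an identity of rational functions of $x$ (equivalently, for every complex $x\notin\{ -z_1,\dots,-z_N\}$), $$\sum_{n=1}^{N}\frac{1}{z_n(z_n+x)}\sum_{m=1}^{n-1}\frac{1}{z_m+x}=\sum_{n=1}^{N}\frac{1}{z_n\tilde z_n}\cdot\frac{1}{z_n+x}.$$
   Context: The numbers $z_i$ must be pairwise distinct for the defining sums of $1/\tilde z_k$ to make sense (here $1/\tilde z_k$ may be $0$; only $1/\tilde z_k$ enters the formula). -}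

module Defs where

open import Level using (Level; _⊔_; suc)
open import Algebra.Bundles using (CommutativeRing)
open import Data.Nat as ℕ using (ℕ; zero)
open import Data.Fin using (Fin; toℕ)
import Data.Fin as Fin
open import Data.Fin.Properties using (_<?_)
open import Data.Bool using (if_then_else_)
open import Relation.Nullary using (¬_)
open import Relation.Nullary.Decidable using (⌊_⌋)

-- A field: a commutative ring with 1 ≠ 0 and a (total) inverse operation
-- that is a two-sided inverse on every nonzero element (value at 0 irrelevant).
record Field (c ℓ : Level) : Set (Level.suc (c ⊔ ℓ)) where
  field
    commutativeRing : CommutativeRing c ℓ
  open CommutativeRing commutativeRing public
  field
    _⁻¹      : Carrier → Carrier
    1≉0      : ¬ (1# ≈ 0#)
    inverseʳ : ∀ x → ¬ (x ≈ 0#) → x * (x ⁻¹) ≈ 1#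

module FieldSums {c ℓ} (F : Field c ℓ) where
  open Field F

  ∑ : (n : ℕ) → (Fin n → Carrier) → Carrier
  ∑ zero    f = 0#
  ∑ (ℕ.suc n) f = f Fin.zero + ∑ n (λ i → f (Fin.suc i))

  ∑below : {n : ℕ} → Fin n → (Fin n → Carrier) → Carrier
  ∑below {n} k f = ∑ n (λ i → if ⌊ i <? k ⌋ then f i else 0#)

  ∑above : {n : ℕ} → Fin n → (Fin n → Carrier) → Carrier
  ∑above {n} k f = ∑ n (λ i → if ⌊ k <? i ⌋ then f i else 0#)

  invTilde : {N : ℕ} → (Fin N → Carrier) → Fin N → Carrier
  invTilde z k =
    ∑below k (λ i → (z i - z k) ⁻¹)
    + ∑above k (λ i → (z i - z k) ⁻¹ - (z i) ⁻¹)

module Submission where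

-- Write P n = (z n (z n + x))⁻¹, w m = (z m + x)⁻¹ and d i k = (z i - z k)⁻¹.
-- The left-hand side of the theorem is the sum of P n · w m over all pairs
-- m < n.  The whole proof rests on the two-point case of the theorem,
-- a partial-fraction identity valid for any two distinct indices m ≠ n:
--
--   P n · w m  =  P n · d m n  +  P m · (d n m - (z n)⁻¹).
--
-- Summing it over the pairs m < n, the first terms collect, for each n, into
-- P n times the "lower" part of 1/z̃ n; in the second terms we exchange the
-- order of the triangular double sum (m < n ⟷ n > m), after which they
-- collect, for each m, into P m times the "upper" part of 1/z̃ m.

open import Defs
open import Data.Nat using (ℕ; zero; suc; _<_)
open import Data.Fin using (Fin)
open import Relation.Nullary using (¬_; yes; no)
open import Relation.Binary.PropositionalEquality using (_≡_)

import Data.Fin as Fin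
open import Data.Fin.Properties using (_<?_; <⇒≢)
open import Data.Bool using (Bool; true; false; if_then_else_)
open import Relation.Nullary.Decidable using (⌊_⌋)
import Relation.Binary.PropositionalEquality as ≡
import Relation.Binary.Reasoning.Setoid as SetoidReasoning
import Algebra.Properties.Ring as RingProperties
import Algebra.Properties.CommutativeSemigroup as CommutativeSemigroupProperties

module FieldAlgebra {c ℓ} (F : Field c ℓ) where
  open Field F
  open RingProperties ring
    using (-‿distribˡ-*; -‿distribʳ-*; -‿involutive; -‿injective; -‿+-comm; -0#≈0#;
           x[y-z]≈xy-xz; [y-z]x≈yx-zx; ⁻¹-anti-homo‿-; x∙y⁻¹≈ε⇒x≈y)
  module ⊛ = CommutativeSemigroupProperties *-commutativeSemigroup
  module ⊕ = CommutativeSemigroupProperties +-commutativeSemigroup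
  open SetoidReasoning setoid

  inverseˡ : ∀ {a} → ¬ a ≈ 0# → a ⁻¹ * a ≈ 1#
  inverseˡ {a} a≉0 = trans (*-comm (a ⁻¹) a) (inverseʳ a a≉0)

  inverse-unique : ∀ a b → a * b ≈ 1# → b ≈ a ⁻¹
  inverse-unique a b ab≈1 = begin
    b               ≈⟨ *-identityˡ b ⟨
    1# * b          ≈⟨ *-congʳ (inverseˡ a≉0) ⟨
    (a ⁻¹ * a) * b  ≈⟨ *-assoc (a ⁻¹) a b ⟩
    a ⁻¹ * (a * b)  ≈⟨ *-congˡ ab≈1 ⟩
    a ⁻¹ * 1#       ≈⟨ *-identityʳ (a ⁻¹) ⟩
    a ⁻¹            ∎
    where
    a≉0 : ¬ a ≈ 0#
    a≉0 a≈0 = 1≉0 (trans (sym ab≈1) (trans (*-congʳ a≈0) (zeroˡ b)))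

  -- The Field record does not require _⁻¹ to respect ≈; on nonzero
  -- elements this follows from uniqueness of inverses.
  ⁻¹-cong : ∀ {a b} → ¬ b ≈ 0# → a ≈ b → a ⁻¹ ≈ b ⁻¹
  ⁻¹-cong {a} {b} b≉0 a≈b =
    sym (inverse-unique a (b ⁻¹) (trans (*-congʳ a≈b) (inverseʳ b b≉0)))

  ⁻¹-distrib-* : ∀ {a b} → ¬ a ≈ 0# → ¬ b ≈ 0# → (a * b) ⁻¹ ≈ a ⁻¹ * b ⁻¹
  ⁻¹-distrib-* {a} {b} a≉0 b≉0 = sym (inverse-unique (a * b) (a ⁻¹ * b ⁻¹) (begin
    (a * b) * (a ⁻¹ * b ⁻¹)    ≈⟨ ⊛.interchange a b (a ⁻¹) (b ⁻¹) ⟩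
    (a * a ⁻¹) * (b * b ⁻¹)    ≈⟨ *-cong (inverseʳ a a≉0) (inverseʳ b b≉0) ⟩
    1# * 1#                    ≈⟨ *-identityˡ 1# ⟩
    1#                         ∎))

  ⁻¹-distrib-neg : ∀ {a} → ¬ a ≈ 0# → (- a) ⁻¹ ≈ - (a ⁻¹)
  ⁻¹-distrib-neg {a} a≉0 = sym (inverse-unique (- a) (- (a ⁻¹)) (begin
    - a * - (a ⁻¹)      ≈⟨ -‿distribˡ-* a (- (a ⁻¹)) ⟨
    - (a * - (a ⁻¹))    ≈⟨ -‿cong (-‿distribʳ-* a (a ⁻¹)) ⟨
    - (- (a * a ⁻¹))    ≈⟨ -‿involutive (a * a ⁻¹) ⟩
    a * a ⁻¹            ≈⟨ inverseʳ a a≉0 ⟩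
    1#                  ∎))

  ⁻¹-cancelˡ : ∀ {a} → ¬ a ≈ 0# → ∀ y → a ⁻¹ * (a * y) ≈ y
  ⁻¹-cancelˡ {a} a≉0 y = begin
    a ⁻¹ * (a * y)  ≈⟨ *-assoc (a ⁻¹) a y ⟨
    (a ⁻¹ * a) * y  ≈⟨ *-congʳ (inverseˡ a≉0) ⟩
    1# * y          ≈⟨ *-identityˡ y ⟩
    y               ∎

  difference-nonzero : ∀ {a b} → ¬ a ≈ b → ¬ a - b ≈ 0#
  difference-nonzero {a} {b} a≉b a-b≈0 = a≉b (x∙y⁻¹≈ε⇒x≈y a b a-b≈0)

  shifted-difference : ∀ a b x → (a + x) - (b + x) ≈ a - b
  shifted-difference a b x = begin
    (a + x) + - (b + x)     ≈⟨ +-congˡ (-‿+-comm b x) ⟨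
    (a + x) + (- b + - x)   ≈⟨ ⊕.interchange a x (- b) (- x) ⟩
    (a - b) + (x - x)       ≈⟨ +-congˡ (-‿inverseʳ x) ⟩
    (a - b) + 0#            ≈⟨ +-identityʳ (a - b) ⟩
    a - b                   ∎

  complementary-difference : ∀ a b → a - (a - b) ≈ b
  complementary-difference a b = begin
    a + - (a - b)    ≈⟨ +-congˡ (⁻¹-anti-homo‿- a b) ⟩
    a + (b - a)      ≈⟨ ⊕.x∙yz≈y∙xz a b (- a) ⟩
    b + (a - a)      ≈⟨ +-congˡ (-‿inverseʳ a) ⟩
    b + 0#           ≈⟨ +-identityʳ b ⟩
    b                ∎

  reciprocal-difference : ∀ {a b} → ¬ a ≈ 0# → ¬ b ≈ 0# →
                          a ⁻¹ - b ⁻¹ ≈ (b - a) * (a ⁻¹ * b ⁻¹)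
  reciprocal-difference {a} {b} a≉0 b≉0 = sym (begin
    (b - a) * (a ⁻¹ * b ⁻¹)                  ≈⟨ [y-z]x≈yx-zx (a ⁻¹ * b ⁻¹) b a ⟩
    b * (a ⁻¹ * b ⁻¹) - a * (a ⁻¹ * b ⁻¹)    ≈⟨ +-cong b-term (-‿cong a-term) ⟩
    a ⁻¹ - b ⁻¹                              ∎)
    where
    b-term : b * (a ⁻¹ * b ⁻¹) ≈ a ⁻¹
    b-term = trans (⊛.x∙yz≈y∙xz b (a ⁻¹) (b ⁻¹))
                   (trans (*-congˡ (inverseʳ b b≉0)) (*-identityʳ (a ⁻¹)))
    a-term : a * (a ⁻¹ * b ⁻¹) ≈ b ⁻¹
    a-term = trans (sym (*-assoc a (a ⁻¹) (b ⁻¹)))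
                   (trans (*-congʳ (inverseʳ a a≉0)) (*-identityˡ (b ⁻¹)))

  partial-fractions : ∀ {a b} → ¬ a ≈ 0# → ¬ b ≈ 0# → ¬ b - a ≈ 0# →
                      a ⁻¹ * b ⁻¹ ≈ (b - a) ⁻¹ * (a ⁻¹ - b ⁻¹)
  partial-fractions {a} {b} a≉0 b≉0 b-a≉0 = sym (begin
    (b - a) ⁻¹ * (a ⁻¹ - b ⁻¹)               ≈⟨ *-congˡ (reciprocal-difference a≉0 b≉0) ⟩
    (b - a) ⁻¹ * ((b - a) * (a ⁻¹ * b ⁻¹))   ≈⟨ ⁻¹-cancelˡ b-a≉0 (a ⁻¹ * b ⁻¹) ⟩
    a ⁻¹ * b ⁻¹                              ∎)

  two-point-identity :
    ∀ {a b} x → ¬ a ≈ 0# → ¬ b ≈ 0# → ¬ a + x ≈ 0# → ¬ b + x ≈ 0# → ¬ a ≈ b →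
    (a * (a + x)) ⁻¹ * (b + x) ⁻¹
      ≈ (a * (a + x)) ⁻¹ * (b - a) ⁻¹ + (b * (b + x)) ⁻¹ * ((a - b) ⁻¹ - a ⁻¹)
  two-point-identity {a} {b} x a≉0 b≉0 A≉0 B≉0 a≉b = begin
    (a * A) ⁻¹ * B ⁻¹                        ≈⟨ *-congʳ (⁻¹-distrib-* a≉0 A≉0) ⟩
    (a ⁻¹ * A ⁻¹) * B ⁻¹                     ≈⟨ *-assoc (a ⁻¹) (A ⁻¹) (B ⁻¹) ⟩
    a ⁻¹ * (A ⁻¹ * B ⁻¹)                     ≈⟨ *-congˡ shifted-partial-fractions ⟩
    a ⁻¹ * (δ * (A ⁻¹ - B ⁻¹))               ≈⟨ *-congˡ (x[y-z]≈xy-xz δ (A ⁻¹) (B ⁻¹)) ⟩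
    a ⁻¹ * (δ * A ⁻¹ - δ * B ⁻¹)             ≈⟨ x[y-z]≈xy-xz (a ⁻¹) (δ * A ⁻¹) (δ * B ⁻¹) ⟩
    a ⁻¹ * (δ * A ⁻¹) - a ⁻¹ * (δ * B ⁻¹)    ≈⟨ +-cong lower-term upper-term ⟩
    (a * A) ⁻¹ * δ + (b * B) ⁻¹ * ((a - b) ⁻¹ - a ⁻¹) ∎
    where
    A B δ : Carrier
    A = a + x
    B = b + x
    δ = (b - a) ⁻¹

    b-a≉0 : ¬ b - a ≈ 0#
    b-a≉0 = difference-nonzero (λ b≈a → a≉b (sym b≈a))

    -- B - A = b - a, so 1/(AB) = (1/A - 1/B)/(b - a).
    shifted-partial-fractions : A ⁻¹ * B ⁻¹ ≈ δ * (A ⁻¹ - B ⁻¹)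
    shifted-partial-fractions = begin
      A ⁻¹ * B ⁻¹               ≈⟨ partial-fractions A≉0 B≉0 (λ B-A≈0 → b-a≉0 (trans (sym B-A≈b-a) B-A≈0)) ⟩
      (B - A) ⁻¹ * (A ⁻¹ - B ⁻¹) ≈⟨ *-congʳ (⁻¹-cong b-a≉0 B-A≈b-a) ⟩
      δ * (A ⁻¹ - B ⁻¹)         ∎
      where
      B-A≈b-a : B - A ≈ b - a
      B-A≈b-a = shifted-difference b a x

    lower-term : a ⁻¹ * (δ * A ⁻¹) ≈ (a * A) ⁻¹ * δ
    lower-term = trans (⊛.x∙yz≈xz∙y (a ⁻¹) δ (A ⁻¹)) (*-congʳ (sym (⁻¹-distrib-* a≉0 A≉0)))

    a-b⁻¹≈-δ : (a - b) ⁻¹ ≈ - δ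
    a-b⁻¹≈-δ = trans (⁻¹-cong -[b-a]≉0 (sym (⁻¹-anti-homo‿- b a))) (⁻¹-distrib-neg b-a≉0)
      where
      -[b-a]≉0 : ¬ - (b - a) ≈ 0#
      -[b-a]≉0 h = b-a≉0 (-‿injective (trans h (sym -0#≈0#)))

    upper-term : - (a ⁻¹ * (δ * B ⁻¹)) ≈ (b * B) ⁻¹ * ((a - b) ⁻¹ - a ⁻¹)
    upper-term = sym (begin
      (b * B) ⁻¹ * ((a - b) ⁻¹ - a ⁻¹)            ≈⟨ *-cong (⁻¹-distrib-* b≉0 B≉0) difference ⟩
      (b ⁻¹ * B ⁻¹) * (b * ((a - b) ⁻¹ * a ⁻¹))   ≈⟨ ⊛.interchange (b ⁻¹) (B ⁻¹) b _ ⟩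
      (b ⁻¹ * b) * (B ⁻¹ * ((a - b) ⁻¹ * a ⁻¹))   ≈⟨ *-congʳ (inverseˡ b≉0) ⟩
      1# * (B ⁻¹ * ((a - b) ⁻¹ * a ⁻¹))           ≈⟨ *-identityˡ _ ⟩
      B ⁻¹ * ((a - b) ⁻¹ * a ⁻¹)                  ≈⟨ *-congˡ (*-congʳ a-b⁻¹≈-δ) ⟩
      B ⁻¹ * (- δ * a ⁻¹)                         ≈⟨ *-congˡ (-‿distribˡ-* δ (a ⁻¹)) ⟨
      B ⁻¹ * - (δ * a ⁻¹)                         ≈⟨ -‿distribʳ-* (B ⁻¹) (δ * a ⁻¹) ⟨
      - (B ⁻¹ * (δ * a ⁻¹))                       ≈⟨ -‿cong (⊛.x∙yz≈z∙yx (B ⁻¹) δ (a ⁻¹)) ⟩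
      - (a ⁻¹ * (δ * B ⁻¹))                       ∎)
      where
      difference : (a - b) ⁻¹ - a ⁻¹ ≈ b * ((a - b) ⁻¹ * a ⁻¹)
      difference = trans (reciprocal-difference (difference-nonzero a≉b) a≉0)
                         (*-congʳ (complementary-difference a b))

module FiniteSums {c ℓ} (F : Field c ℓ) where
  open Field F
  open FieldSums F
  module ⊕ = CommutativeSemigroupProperties +-commutativeSemigroup
  open SetoidReasoning setoid

  ∑-cong : ∀ n {f g : Fin n → Carrier} → (∀ i → f i ≈ g i) → ∑ n f ≈ ∑ n g
  ∑-cong zero    f≈g = refl
  ∑-cong (suc n) f≈g = +-cong (f≈g Fin.zero) (∑-cong n (λ i → f≈g (Fin.suc i)))

  ∑-zero : ∀ n → ∑ n (λ _ → 0#) ≈ 0#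
  ∑-zero zero    = refl
  ∑-zero (suc n) = trans (+-congˡ (∑-zero n)) (+-identityʳ 0#)

  ∑-+ : ∀ n (f g : Fin n → Carrier) → ∑ n (λ i → f i + g i) ≈ ∑ n f + ∑ n g
  ∑-+ zero    f g = sym (+-identityʳ 0#)
  ∑-+ (suc n) f g = begin
    (f Fin.zero + g Fin.zero) + ∑ n (λ i → f (Fin.suc i) + g (Fin.suc i))
      ≈⟨ +-congˡ (∑-+ n (λ i → f (Fin.suc i)) (λ i → g (Fin.suc i))) ⟩
    (f Fin.zero + g Fin.zero) + (∑ n (λ i → f (Fin.suc i)) + ∑ n (λ i → g (Fin.suc i)))
      ≈⟨ ⊕.interchange _ _ _ _ ⟩
    (f Fin.zero + ∑ n (λ i → f (Fin.suc i))) + (g Fin.zero + ∑ n (λ i → g (Fin.suc i))) ∎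

  ∑-*ˡ : ∀ n a (f : Fin n → Carrier) → a * ∑ n f ≈ ∑ n (λ i → a * f i)
  ∑-*ˡ zero    a f = zeroʳ a
  ∑-*ˡ (suc n) a f = trans (distribˡ a _ _) (+-congˡ (∑-*ˡ n a (λ i → f (Fin.suc i))))

  ∑-swap : ∀ n m (f : Fin n → Fin m → Carrier) →
           ∑ n (λ i → ∑ m (f i)) ≈ ∑ m (λ j → ∑ n (λ i → f i j))
  ∑-swap zero    m f = sym (∑-zero m)
  ∑-swap (suc n) m f = begin
    ∑ m (f Fin.zero) + ∑ n (λ i → ∑ m (f (Fin.suc i)))
      ≈⟨ +-congˡ (∑-swap n m (λ i → f (Fin.suc i))) ⟩
    ∑ m (f Fin.zero) + ∑ m (λ j → ∑ n (λ i → f (Fin.suc i) j))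
      ≈⟨ ∑-+ m (f Fin.zero) (λ j → ∑ n (λ i → f (Fin.suc i) j)) ⟨
    ∑ m (λ j → ∑ (suc n) (λ i → f i j)) ∎

  ∑-guarded-*ˡ : ∀ {n} (p : Fin n → Bool) a (f : Fin n → Carrier) →
    a * ∑ n (λ i → if p i then f i else 0#) ≈ ∑ n (λ i → if p i then a * f i else 0#)
  ∑-guarded-*ˡ {n} p a f = trans (∑-*ˡ n a _) (∑-cong n (λ i → guarded-*ˡ (p i)))
    where
    guarded-*ˡ : ∀ {i} b → a * (if b then f i else 0#) ≈ (if b then a * f i else 0#)
    guarded-*ˡ true  = refl
    guarded-*ˡ false = zeroʳ a

  ∑-guarded-+ : ∀ {n} (p : Fin n → Bool) (f g : Fin n → Carrier) →
    ∑ n (λ i → if p i then f i + g i else 0#)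
      ≈ ∑ n (λ i → if p i then f i else 0#) + ∑ n (λ i → if p i then g i else 0#)
  ∑-guarded-+ {n} p f g = trans (∑-cong n (λ i → guarded-+ (p i))) (∑-+ n _ _)
    where
    guarded-+ : ∀ {i} b → (if b then f i + g i else 0#)
                          ≈ (if b then f i else 0#) + (if b then g i else 0#)
    guarded-+ true  = refl
    guarded-+ false = sym (+-identityʳ 0#)

  ∑below-cong : ∀ {n} (k : Fin n) {f g : Fin n → Carrier} →
                (∀ i → i Fin.< k → f i ≈ g i) → ∑below k f ≈ ∑below k g
  ∑below-cong {n} k {f} {g} f≈g = ∑-cong n guarded
    where
    guarded : ∀ i → (if ⌊ i <? k ⌋ then f i else 0#) ≈ (if ⌊ i <? k ⌋ then g i else 0#)
    guarded i with i <? k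
    ... | yes i<k = f≈g i i<k
    ... | no  _   = refl

  ∑below-∑above-swap : ∀ n (g : Fin n → Fin n → Carrier) →
    ∑ n (λ k → ∑below k (λ i → g i k)) ≈ ∑ n (λ i → ∑above i (λ k → g i k))
  ∑below-∑above-swap n g = ∑-swap n n (λ k i → if ⌊ i <? k ⌋ then g i k else 0#)

-- Sum the two-point identity over the pairs m < n and regroup (see the
-- opening comment).
theorem3p1 : ∀ {c ℓ} (F : Field c ℓ) → 
    let open Field F
        open FieldSums F
    in
    (N : ℕ) → 1 < N → (z : Fin N → Carrier) →
    (∀ i j → ¬ (i ≡ j) → ¬ (z i ≈ z j)) →
    (∀ i → ¬ (z i ≈ 0#)) →
    (x : Carrier) → (∀ n → ¬ (z n + x ≈ 0#)) →
    ∑ N (λ n → (z n * (z n + x)) ⁻¹ * ∑below n (λ m → (z m + x) ⁻¹))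
      ≈ ∑ N (λ n → (z n * (z n + x)) ⁻¹ * invTilde z n)
theorem3p1 F N _ z distinct nonzero x shifted-nonzero = begin
  ∑ N (λ n → P n * ∑below n w)
    ≈⟨ ∑-cong N (λ n → ∑-guarded-*ˡ (λ m → ⌊ m <? n ⌋) (P n) w) ⟩
  ∑ N (λ n → ∑below n (λ m → P n * w m))
    ≈⟨ ∑-cong N (λ n → ∑below-cong n (two-point n)) ⟩
  ∑ N (λ n → ∑below n (λ m → P n * d m n + P m * (d n m - u n)))
    ≈⟨ ∑-cong N (λ n → ∑-guarded-+ (λ m → ⌊ m <? n ⌋) (λ m → P n * d m n) (λ m → P m * (d n m - u n))) ⟩
  ∑ N (λ n → ∑below n (λ m → P n * d m n) + ∑below n (λ m → P m * (d n m - u n)))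
    ≈⟨ ∑-+ N _ _ ⟩
  ∑ N (λ n → ∑below n (λ m → P n * d m n)) + ∑ N (λ n → ∑below n (λ m → P m * (d n m - u n)))
    ≈⟨ +-congˡ (∑below-∑above-swap N (λ m n → P m * (d n m - u n))) ⟩
  ∑ N (λ n → ∑below n (λ m → P n * d m n)) + ∑ N (λ m → ∑above m (λ n → P m * (d n m - u n)))
    ≈⟨ +-cong (∑-cong N (λ n → ∑-guarded-*ˡ (λ m → ⌊ m <? n ⌋) (P n) (λ m → d m n)))
              (∑-cong N (λ m → ∑-guarded-*ˡ (λ n → ⌊ m <? n ⌋) (P m) (λ n → d n m - u n))) ⟨
  ∑ N (λ n → P n * ∑below n (λ m → d m n)) + ∑ N (λ n → P n * ∑above n (λ i → d i n - u i))
    ≈⟨ ∑-+ N _ _ ⟨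
  ∑ N (λ n → P n * ∑below n (λ m → d m n) + P n * ∑above n (λ i → d i n - u i))
    ≈⟨ ∑-cong N (λ n → distribˡ (P n) _ _) ⟨
  ∑ N (λ n → P n * invTilde z n) ∎
  where
  open Field F
  open FieldSums F
  open FieldAlgebra F
  open FiniteSums F
  open SetoidReasoning setoid

  P w u : Fin N → Carrier
  P n = (z n * (z n + x)) ⁻¹
  w m = (z m + x) ⁻¹
  u n = z n ⁻¹

  d : Fin N → Fin N → Carrier
  d i k = (z i - z k) ⁻¹

  two-point : ∀ n m → m Fin.< n → P n * w m ≈ P n * d m n + P m * (d n m - u n)
  two-point n m m<n = two-point-identity x (nonzero n) (nonzero m)
    (shifted-nonzero n) (shifted-nonzero m) (distinct n m (λ n≡m → <⇒≢ m<n (≡.sym n≡m)))
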